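{- Let $G$ be a connected graph on $n\geq 2$ vertices and let $u,v$ be two distinct vertices of $G$ with $f_G(u)\geq f_G(v)$. For integers $n_1,n_2\geq 0$, let $G_{uv}(n_1,n_2)$ be the graph obtained from $G$ by attaching $n_1$ new pendant vertices at $u$ and $n_2$ new pendant vertices at $v$. If $n_1,n_2\geq 1$, then $F(G_{uv}(n_1+n_2,0))>F(G_{uv}(n_1,n_2))$.
   Context: All graphs are finite, simple and undirected. A connected subgraph of a graph $G=(V,E)$ is a graph $(V',E')$ with $\emptyset\neq V'\subseteq V$, $E'\subseteq E$, every edge of $E'$ having both endpoints in $V'$, and $(V',E')$ connected; distinct pairs $(V',E')$ are counted separately. The core index $F(G)$ is the number of connected subgraphs of $G$, and for $x\in V(G)$, $f_G(x)$ is the number of connected subgraphs of $G$ containing $x$. -}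

module Defs where

open import Data.Nat using (ℕ; zero; suc; _+_)
open import Data.Bool using (Bool; true; false; _∧_; _∨_; if_then_else_; T)
open import Data.Fin using (Fin; zero; suc; _↑ˡ_; _↑ʳ_)
open import Data.Fin.Properties using (_≟_)
open import Data.Fin.Subset using (Subset; inside; outside)
open import Data.Vec using (Vec; []; _∷_; lookup)
open import Data.Product using (_×_; _,_; proj₁; proj₂)
open import Relation.Nullary using (¬_)
open import Relation.Nullary.Decidable using (⌊_⌋)
open import Relation.Binary.PropositionalEquality using (_≡_)
open import Data.Sum using (_⊎_)

record Graph : Set where
  field
    n    : ℕ
    m    : ℕ
    ends : Fin m → Fin n × Fin n
open Graph public

Simple : Graph → Set
Simple G =
  (∀ e → ¬ (proj₁ (ends G e) ≡ proj₂ (ends G e))) ×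
  (∀ e e' → (ends G e ≡ ends G e' ⊎ (proj₁ (ends G e) ≡ proj₂ (ends G e') × proj₂ (ends G e) ≡ proj₁ (ends G e'))) → e ≡ e')

anyF : ∀ k → (Fin k → Bool) → Bool
anyF zero    p = false
anyF (suc k) p = p zero ∨ anyF k (λ i → p (suc i))

allF : ∀ k → (Fin k → Bool) → Bool
allF zero    p = true
allF (suc k) p = p zero ∧ allF k (λ i → p (suc i))

sumSub : ∀ k → (Subset k → ℕ) → ℕ
sumSub zero    f = f []
sumSub (suc k) f = sumSub k (λ s → f (inside ∷ s)) + sumSub k (λ s → f (outside ∷ s))

countSub : ∀ k → (Subset k → Bool) → ℕ
countSub k p = sumSub k (λ s → if p s then 1 else 0)

_⇒ᵇ_ : Bool → Bool → Bool
true  ⇒ᵇ b = b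
false ⇒ᵇ b = true

_∈ᵇ_ : ∀ {k} → Fin k → Subset k → Bool
x ∈ᵇ S = lookup S x

module _ (G : Graph) where

  reach : Subset (m G) → ℕ → Fin (n G) → Fin (n G) → Bool
  reach E' zero    x y = ⌊ x ≟ y ⌋
  reach E' (suc k) x y = reach E' k x y ∨
    anyF (m G) (λ e → (e ∈ᵇ E') ∧
      ((⌊ proj₁ (ends G e) ≟ x ⌋ ∧ reach E' k (proj₂ (ends G e)) y) ∨
       (⌊ proj₂ (ends G e) ≟ x ⌋ ∧ reach E' k (proj₁ (ends G e)) y)))

  -- (V',E') is a connected subgraph of G: V' nonempty, each edge of E' has
  -- both endpoints in V', and any two vertices of V' are joined by a walk in
  -- E' (a walk exists iff one of length ≤ n exists).
  isConnSub : Subset (n G) → Subset (m G) → Bool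
  isConnSub V' E' =
    anyF (n G) (λ x → x ∈ᵇ V') ∧
    allF (m G) (λ e → (e ∈ᵇ E') ⇒ᵇ ((proj₁ (ends G e) ∈ᵇ V') ∧ (proj₂ (ends G e) ∈ᵇ V'))) ∧
    allF (n G) (λ x → allF (n G) (λ y →
      ((x ∈ᵇ V') ∧ (y ∈ᵇ V')) ⇒ᵇ reach E' (n G) x y))


  F : ℕ
  F = sumSub (n G) (λ V' → countSub (m G) (λ E' → isConnSub V' E'))

  f : Fin (n G) → ℕ
  f x = sumSub (n G) (λ V' → countSub (m G) (λ E' → (x ∈ᵇ V') ∧ isConnSub V' E'))

  Connected : Set
  Connected = T (isConnSub (Data.Fin.Subset.⊤) (Data.Fin.Subset.⊤))
    where import Data.Fin.Subset

  -- G_uv(n1,n2): vertices Fin ((n + n1) + n2); old vertex x is (x ↑ˡ n1) ↑ˡ n2,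
  -- the i-th pendant at u is (n ↑ʳ i) ↑ˡ n2, the j-th pendant at v is
  -- (n + n1) ↑ʳ j.
  attach : Fin (n G) → Fin (n G) → ℕ → ℕ → Graph
  attach u v n1 n2 = record
    { n = (n G + n1) + n2
    ; m = (m G + n1) + n2
    ; ends = λ e → [ (λ e₁ → [ (λ e₀ → old (proj₁ (ends G e₀)) , old (proj₂ (ends G e₀)))
                             , (λ i → old u , (n G ↑ʳ i) ↑ˡ n2) ]′ (splitAt (m G) e₁))
                   , (λ j → old v , (n G + n1) ↑ʳ j) ]′ (splitAt (m G + n1) e)
    }
    where
      open import Data.Sum using ([_,_]′)
      open import Data.Fin using (splitAt)
      old : Fin (n G) → Fin ((n G + n1) + n2)
      old x = (x ↑ˡ n1) ↑ˡ n2

module Submission where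

-- Let H = G_uv(a,b).  A vertex set of H splits as V' = (Vs ++ Vt) ++ Vr
-- (old vertices, pendants at u, pendants at v), an edge set likewise as
-- E' = (Es ++ Et) ++ Er.  When Vs is nonempty, (V',E') is a connected
-- subgraph of H exactly when (Vs,Es) is one of G, every pendant block is
-- "admissible" (its vertex part equals its edge part, and it is empty unless
-- its anchor u resp. v lies in Vs); when Vs is empty, exactly when V' is a
-- single pendant vertex and E' is empty.  Summing over all parts yields
--   F(G_uv(a,b)) = Σ_Vs C(Vs) · w_a(u ∈ Vs) · w_b(v ∈ Vs) + (a + b),
-- with C(Vs) the number of edge sets making Vs connected and w_a(β) = 2^a if β
-- else 1.  Likewise f_G(x) = Σ_{x ∈ Vs} C(Vs).  Writing 2^a = 1+P, 2^b = 1+Q,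
-- the first main sum for (a+b,0) exceeds the one for (a,b) by
--   Q·P·Σ_{u ∈ Vs ∌ v} C(Vs) + Q·(f(u) - f(v)),
-- which is positive since f(u) ≥ f(v) and the singleton {u} is connected.

open import Defs
open import Data.Nat using (ℕ; zero; suc; _≥_; _>_; _+_; _*_; _^_; _≤_; _<_; _∸_; z≤n; s≤s)
open import Data.Nat.Properties hiding (_≟_; suc-injective)
open import Data.Nat.Tactic.RingSolver using (solve-∀)
open import Data.Bool using (Bool; true; false; _∧_; _∨_; if_then_else_; not)
open import Data.Bool.Properties using (∨-zeroʳ; ∨-identityʳ; ¬-not) renaming (_≟_ to _≟ᵇ_)
open import Data.Fin using (Fin; zero; suc; _↑ˡ_; _↑ʳ_; splitAt)
open import Data.Fin.Properties
  using (_≟_; suc-injective; splitAt-↑ˡ; splitAt-↑ʳ; splitAt⁻¹-↑ˡ; splitAt⁻¹-↑ʳ; ↑ˡ-injective; ↑ʳ-injective)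
open import Data.Fin.Subset using (Subset)
open import Data.Vec using (Vec; []; _∷_; lookup; _++_; replicate; tabulate)
open import Data.Vec.Properties using (lookup-++ˡ; lookup-++ʳ; lookup∘tabulate; lookup-replicate)
open import Data.Product using (Σ; _×_; _,_; proj₁; proj₂)
open import Data.Sum using (_⊎_; inj₁; inj₂; [_,_]′)
open import Data.Empty using (⊥; ⊥-elim)
open import Relation.Nullary using (¬_; yes; no)
open import Relation.Nullary.Decidable using (⌊_⌋)
open import Relation.Binary.PropositionalEquality

false≢true : ∀ {A : Set} → false ≡ true → A
false≢true ()

∧-elimˡ : ∀ {x y} → x ∧ y ≡ true → x ≡ true
∧-elimˡ {true}  p = refl
∧-elimˡ {false} p = false≢true p

∧-elimʳ : ∀ {x y} → x ∧ y ≡ true → y ≡ true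
∧-elimʳ {true}  p = p
∧-elimʳ {false} p = false≢true p

∧-intro : ∀ {x y} → x ≡ true → y ≡ true → x ∧ y ≡ true
∧-intro refl q = q

∨-elim : ∀ {x y} → x ∨ y ≡ true → x ≡ true ⊎ y ≡ true
∨-elim {true}  p = inj₁ refl
∨-elim {false} p = inj₂ p

∨-introˡ : ∀ {x y} → x ≡ true → x ∨ y ≡ true
∨-introˡ refl = refl

∨-introʳ : ∀ {x y} → y ≡ true → x ∨ y ≡ true
∨-introʳ {true}  p = refl
∨-introʳ {false} p = p

⇒-elim : ∀ {x y} → x ⇒ᵇ y ≡ true → x ≡ true → y ≡ true
⇒-elim p refl = p

⇒-intro : ∀ {x y} → (x ≡ true → y ≡ true) → x ⇒ᵇ y ≡ true
⇒-intro {true}  h = h refl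
⇒-intro {false} h = refl

≟-sound : ∀ {k} {x y : Fin k} → ⌊ x ≟ y ⌋ ≡ true → x ≡ y
≟-sound {x = x} {y} p with x ≟ y
... | yes x≡y = x≡y
... | no  _   = false≢true p

≟-complete : ∀ {k} {x y : Fin k} → x ≡ y → ⌊ x ≟ y ⌋ ≡ true
≟-complete {x = x} {y} x≡y with x ≟ y
... | yes _   = refl
... | no  x≢y = ⊥-elim (x≢y x≡y)

bool-ext : ∀ {x y} → (x ≡ true → y ≡ true) → (y ≡ true → x ≡ true) → x ≡ y
bool-ext {true}          to from = sym (to refl)
bool-ext {false} {true}  to from = from refl
bool-ext {false} {false} to from = refl

⟦_⟧ : Bool → ℕ
⟦ b ⟧ = if b then 1 else 0

⟦∧⟧ : ∀ x y → ⟦ x ∧ y ⟧ ≡ ⟦ x ⟧ * ⟦ y ⟧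
⟦∧⟧ true  y = sym (+-identityʳ ⟦ y ⟧)
⟦∧⟧ false y = refl

anyF-intro : ∀ k (p : Fin k → Bool) i → p i ≡ true → anyF k p ≡ true
anyF-intro (suc k) p zero    q = ∨-introˡ q
anyF-intro (suc k) p (suc i) q = ∨-introʳ {p zero} (anyF-intro k (λ j → p (suc j)) i q)

anyF-elim : ∀ k (p : Fin k → Bool) → anyF k p ≡ true → Σ (Fin k) λ i → p i ≡ true
anyF-elim (suc k) p q with ∨-elim {p zero} q
... | inj₁ r = zero , r
... | inj₂ r with anyF-elim k (λ j → p (suc j)) r
...   | i , s = suc i , s

allF-intro : ∀ k (p : Fin k → Bool) → (∀ i → p i ≡ true) → allF k p ≡ true
allF-intro zero    p h = refl
allF-intro (suc k) p h = ∧-intro (h zero) (allF-intro k (λ j → p (suc j)) (λ i → h (suc i)))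

allF-elim : ∀ k (p : Fin k → Bool) → allF k p ≡ true → ∀ i → p i ≡ true
allF-elim (suc k) p q zero    = ∧-elimˡ q
allF-elim (suc k) p q (suc i) = allF-elim k (λ j → p (suc j)) (∧-elimʳ {p zero} q) i

anyF-cong : ∀ k (p q : Fin k → Bool) → (∀ i → p i ≡ q i) → anyF k p ≡ anyF k q
anyF-cong zero    p q h = refl
anyF-cong (suc k) p q h = cong₂ _∨_ (h zero) (anyF-cong k _ _ (λ i → h (suc i)))

sumSub-cong : ∀ k {f g : Subset k → ℕ} → (∀ s → f s ≡ g s) → sumSub k f ≡ sumSub k g
sumSub-cong zero    h = h []
sumSub-cong (suc k) h =
  cong₂ _+_ (sumSub-cong k (λ s → h (true ∷ s))) (sumSub-cong k (λ s → h (false ∷ s)))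

sumSub-+ : ∀ k (f g : Subset k → ℕ) → sumSub k (λ s → f s + g s) ≡ sumSub k f + sumSub k g
sumSub-+ zero    f g = refl
sumSub-+ (suc k) f g =
  trans (cong₂ _+_ (sumSub-+ k _ _) (sumSub-+ k _ _))
        (+-shuffle (sumSub k (λ s → f (true ∷ s))) (sumSub k (λ s → g (true ∷ s)))
                   (sumSub k (λ s → f (false ∷ s))) (sumSub k (λ s → g (false ∷ s))))
  where
  +-shuffle : ∀ a b c d → (a + b) + (c + d) ≡ (a + c) + (b + d)
  +-shuffle = solve-∀

sumSub-*ˡ : ∀ k c (f : Subset k → ℕ) → sumSub k (λ s → c * f s) ≡ c * sumSub k f
sumSub-*ˡ zero    c f = refl
sumSub-*ˡ (suc k) c f =
  trans (cong₂ _+_ (sumSub-*ˡ k c _) (sumSub-*ˡ k c _)) (sym (*-distribˡ-+ c _ _))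

sumSub-*ʳ : ∀ k c (f : Subset k → ℕ) → sumSub k (λ s → f s * c) ≡ sumSub k f * c
sumSub-*ʳ k c f =
  trans (sumSub-cong k (λ s → *-comm (f s) c)) (trans (sumSub-*ˡ k c f) (*-comm c _))

sumSub-zero : ∀ k → sumSub k (λ _ → 0) ≡ 0
sumSub-zero zero    = refl
sumSub-zero (suc k) = cong₂ _+_ (sumSub-zero k) (sumSub-zero k)

sumSub-one : ∀ k → sumSub k (λ _ → 1) ≡ 2 ^ k
sumSub-one zero    = refl
sumSub-one (suc k) =
  trans (cong₂ _+_ (sumSub-one k) (sumSub-one k)) (cong (2 ^ k +_) (sym (+-identityʳ (2 ^ k))))

sumSub-≥ : ∀ k (f : Subset k → ℕ) s → f s ≤ sumSub k f
sumSub-≥ zero    f []           = ≤-refl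
sumSub-≥ (suc k) f (true  ∷ s) = ≤-trans (sumSub-≥ k _ s) (m≤m+n _ _)
sumSub-≥ (suc k) f (false ∷ s) = ≤-trans (sumSub-≥ k _ s) (m≤n+m _ _)

sumSub-++ : ∀ k j (f : Subset (k + j) → ℕ) →
  sumSub (k + j) f ≡ sumSub k (λ s → sumSub j (λ t → f (s ++ t)))
sumSub-++ zero    j f = refl
sumSub-++ (suc k) j f = cong₂ _+_ (sumSub-++ k j _) (sumSub-++ k j _)

sumSub-++₃ : ∀ k a b (f : Subset ((k + a) + b) → ℕ) →
  sumSub ((k + a) + b) f ≡ sumSub k (λ x → sumSub a (λ y → sumSub b (λ z → f ((x ++ y) ++ z))))
sumSub-++₃ k a b f = trans (sumSub-++ (k + a) b f) (sumSub-++ k a (λ w → sumSub b (λ z → f (w ++ z))))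

sum₃ : ∀ k₁ k₂ k₃ → (Subset k₁ → Subset k₂ → Subset k₃ → ℕ) → ℕ
sum₃ k₁ k₂ k₃ f = sumSub k₁ (λ x → sumSub k₂ (λ y → sumSub k₃ (λ z → f x y z)))

sum₃-cong : ∀ k₁ k₂ k₃ {f g : Subset k₁ → Subset k₂ → Subset k₃ → ℕ} →
  (∀ x y z → f x y z ≡ g x y z) → sum₃ k₁ k₂ k₃ f ≡ sum₃ k₁ k₂ k₃ g
sum₃-cong k₁ k₂ k₃ h = sumSub-cong k₁ (λ x → sumSub-cong k₂ (λ y → sumSub-cong k₃ (λ z → h x y z)))

sum₃-+ : ∀ k₁ k₂ k₃ (f g : Subset k₁ → Subset k₂ → Subset k₃ → ℕ) →
  sum₃ k₁ k₂ k₃ (λ x y z → f x y z + g x y z) ≡ sum₃ k₁ k₂ k₃ f + sum₃ k₁ k₂ k₃ g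
sum₃-+ k₁ k₂ k₃ f g =
  trans (sumSub-cong k₁ (λ x → trans (sumSub-cong k₂ (λ y → sumSub-+ k₃ _ _)) (sumSub-+ k₂ _ _)))
        (sumSub-+ k₁ _ _)

sum₃-product : ∀ k₁ k₂ k₃ (A : Subset k₁ → ℕ) (B : Subset k₂ → ℕ) (C : Subset k₃ → ℕ) →
  sum₃ k₁ k₂ k₃ (λ x y z → A x * (B y * C z)) ≡ sumSub k₁ A * (sumSub k₂ B * sumSub k₃ C)
sum₃-product k₁ k₂ k₃ A B C =
  trans (sumSub-cong k₁ (λ x → sumSub-cong k₂ (λ y →
          trans (sumSub-*ˡ k₃ (A x) _) (cong (A x *_) (sumSub-*ˡ k₃ (B y) C)))))
  (trans (sumSub-cong k₁ (λ x →
          trans (sumSub-*ˡ k₂ (A x) _) (cong (A x *_) (sumSub-*ʳ k₂ (sumSub k₃ C) B))))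
         (sumSub-*ʳ k₁ _ A))

emptyᵇ : ∀ {k} → Subset k → Bool
emptyᵇ []          = true
emptyᵇ (true  ∷ s) = false
emptyᵇ (false ∷ s) = emptyᵇ s

singleᵇ : ∀ {k} → Subset k → Bool
singleᵇ []          = false
singleᵇ (true  ∷ s) = emptyᵇ s
singleᵇ (false ∷ s) = singleᵇ s

eqᵇ : ∀ {k} → Subset k → Subset k → Bool
eqᵇ []      []      = true
eqᵇ (x ∷ s) (y ∷ t) = (if x then y else not y) ∧ eqᵇ s t

empty-sound : ∀ {k} (s : Subset k) → emptyᵇ s ≡ true → ∀ i → lookup s i ≡ false
empty-sound (true  ∷ s) p i       = false≢true p
empty-sound (false ∷ s) p zero    = refl
empty-sound (false ∷ s) p (suc i) = empty-sound s p i

empty-complete : ∀ {k} (s : Subset k) → (∀ i → lookup s i ≡ false) → emptyᵇ s ≡ true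
empty-complete []          h = refl
empty-complete (true  ∷ s) h = false≢true (sym (h zero))
empty-complete (false ∷ s) h = empty-complete s (λ i → h (suc i))

nonempty-witness : ∀ {k} (s : Subset k) → emptyᵇ s ≡ false → Σ (Fin k) λ i → lookup s i ≡ true
nonempty-witness (true  ∷ s) p = zero , refl
nonempty-witness (false ∷ s) p with nonempty-witness s p
... | i , q = suc i , q

single-sound : ∀ {k} (s : Subset k) → singleᵇ s ≡ true →
  Σ (Fin k) λ i → lookup s i ≡ true × (∀ j → lookup s j ≡ true → j ≡ i)
single-sound (true ∷ s) p = zero , refl , only
  where
  only : ∀ j → lookup (true ∷ s) j ≡ true → j ≡ zero
  only zero    _ = refl
  only (suc j) q = false≢true (trans (sym (empty-sound s p j)) q)
single-sound (false ∷ s) p with single-sound s p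
... | i , q , unique = suc i , q , only
  where
  only : ∀ j → lookup (false ∷ s) j ≡ true → j ≡ suc i
  only zero    q′ = false≢true q′
  only (suc j) q′ = cong suc (unique j q′)

single-complete : ∀ {k} (s : Subset k) i → lookup s i ≡ true →
  (∀ j → lookup s j ≡ true → j ≡ i) → singleᵇ s ≡ true
single-complete (true ∷ s) zero q unique =
  empty-complete s (λ j → ¬-not (λ r → zero≢suc (sym (unique (suc j) r))))
  where
  zero≢suc : ∀ {k} {j : Fin k} → Fin.zero ≢ suc j
  zero≢suc ()
single-complete (true  ∷ s) (suc i) q unique with unique zero refl
... | ()
single-complete (false ∷ s) zero    q unique = false≢true q
single-complete (false ∷ s) (suc i) q unique =
  single-complete s i q (λ j r → suc-injective (unique (suc j) r))

eq-sound : ∀ {k} (s t : Subset k) → eqᵇ s t ≡ true → ∀ i → lookup s i ≡ lookup t i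
eq-sound (true  ∷ s) (true  ∷ t) p zero = refl
eq-sound (false ∷ s) (false ∷ t) p zero = refl
eq-sound (x ∷ s) (y ∷ t) p (suc i) = eq-sound s t (∧-elimʳ {if x then y else not y} p) i

eq-complete : ∀ {k} (s t : Subset k) → (∀ i → lookup s i ≡ lookup t i) → eqᵇ s t ≡ true
eq-complete []      []      h = refl
eq-complete (x ∷ s) (y ∷ t) h = ∧-intro (head-agrees (h zero)) (eq-complete s t (λ i → h (suc i)))
  where
  head-agrees : ∀ {x y} → x ≡ y → (if x then y else not y) ≡ true
  head-agrees {true}  refl = refl
  head-agrees {false} refl = refl

sumSub-at-empty : ∀ k (g : Subset k → ℕ) → sumSub k (λ s → ⟦ emptyᵇ s ⟧ * g s) ≡ g (replicate k false)
sumSub-at-empty zero    g = +-identityʳ (g [])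
sumSub-at-empty (suc k) g =
  trans (cong (_+ sumSub k (λ s → ⟦ emptyᵇ s ⟧ * g (false ∷ s))) (sumSub-zero k))
        (sumSub-at-empty k (λ s → g (false ∷ s)))

count-empty : ∀ k → sumSub k (λ s → ⟦ emptyᵇ s ⟧) ≡ 1
count-empty k = trans (sumSub-cong k (λ s → sym (*-identityʳ ⟦ emptyᵇ s ⟧))) (sumSub-at-empty k (λ _ → 1))

count-single : ∀ k → sumSub k (λ s → ⟦ singleᵇ s ⟧) ≡ k
count-single zero    = refl
count-single (suc k) = cong₂ _+_ (count-empty k) (count-single k)

sumSub-diagonal : ∀ k (h : Subset k → ℕ) → sumSub k (λ s → sumSub k (λ t → ⟦ eqᵇ s t ⟧ * h t)) ≡ sumSub k h
sumSub-diagonal zero    h = +-identityʳ (h [])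
sumSub-diagonal (suc k) h = cong₂ _+_
  (trans (sumSub-cong k (λ s → trans (cong (sumSub k (λ t → ⟦ eqᵇ s t ⟧ * h (true ∷ t)) +_) (sumSub-zero k))
                                     (+-identityʳ _)))
         (sumSub-diagonal k _))
  (trans (sumSub-cong k (λ s → cong (_+ sumSub k (λ t → ⟦ eqᵇ s t ⟧ * h (false ∷ t))) (sumSub-zero k)))
         (sumSub-diagonal k _))

count-empty₃ : ∀ k₁ k₂ k₃ K →
  sum₃ k₁ k₂ k₃ (λ x y z → K * ⟦ emptyᵇ x ∧ (emptyᵇ y ∧ emptyᵇ z) ⟧) ≡ K
count-empty₃ k₁ k₂ k₃ K =
  trans (sum₃-cong k₁ k₂ k₃ (λ x y z → trans (cong (K *_) (trans (⟦∧⟧ (emptyᵇ x) _) (cong (⟦ emptyᵇ x ⟧ *_) (⟦∧⟧ (emptyᵇ y) _))))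
                                             (sym (*-assoc K ⟦ emptyᵇ x ⟧ _))))
  (trans (sum₃-product k₁ k₂ k₃ (λ x → K * ⟦ emptyᵇ x ⟧) _ _)
  (trans (cong₂ _*_ (trans (sumSub-*ˡ k₁ K _) (cong (K *_) (count-empty k₁))) (cong₂ _*_ (count-empty k₂) (count-empty k₃)))
         (trans (*-identityʳ (K * 1)) (*-identityʳ K))))

count-late-singletons : ∀ k a b →
  sum₃ k a b (λ Vs Vt Vr → ⟦ emptyᵇ Vs ∧ singleᵇ ((Vs ++ Vt) ++ Vr) ⟧) ≡ a + b
count-late-singletons k a b =
  trans (sumSub-cong k (λ Vs → trans (sumSub-cong a (λ Vt → trans (sumSub-cong b (λ Vr → ⟦∧⟧ (emptyᵇ Vs) _))
                                                                   (sumSub-*ˡ b ⟦ emptyᵇ Vs ⟧ _)))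
                                     (sumSub-*ˡ a ⟦ emptyᵇ Vs ⟧ _)))
  (trans (sumSub-at-empty k (λ Vs → sumSub a (λ Vt → sumSub b (λ Vr → ⟦ singleᵇ ((Vs ++ Vt) ++ Vr) ⟧))))
  (trans (sumSub-cong a (λ Vt → sumSub-cong b (λ Vr → cong ⟦_⟧ (single-padded k Vt Vr))))
  (trans (sym (sumSub-++ a b (λ W → ⟦ singleᵇ W ⟧))) (count-single (a + b)))))
  where
  single-padded : ∀ k (Vt : Subset a) (Vr : Subset b) →
    singleᵇ ((replicate k false ++ Vt) ++ Vr) ≡ singleᵇ (Vt ++ Vr)
  single-padded zero    Vt Vr = refl
  single-padded (suc k) Vt Vr = single-padded k Vt Vr

admissible : ∀ {k} → Bool → Subset k → Subset k → Bool
admissible β T S = eqᵇ T S ∧ (emptyᵇ S ∨ β)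

weight : ℕ → Bool → ℕ
weight a β = if β then 2 ^ a else 1

count-admissible : ∀ a β → sumSub a (λ T → sumSub a (λ S → ⟦ admissible β T S ⟧)) ≡ weight a β
count-admissible a β =
  trans (sumSub-cong a (λ T → sumSub-cong a (λ S → ⟦∧⟧ (eqᵇ T S) _)))
        (trans (sumSub-diagonal a (λ S → ⟦ emptyᵇ S ∨ β ⟧)) (by-anchor β))
  where
  by-anchor : ∀ β → sumSub a (λ S → ⟦ emptyᵇ S ∨ β ⟧) ≡ weight a β
  by-anchor true  = trans (sumSub-cong a (λ S → cong ⟦_⟧ (∨-zeroʳ (emptyᵇ S)))) (sumSub-one a)
  by-anchor false = trans (sumSub-cong a (λ S → cong ⟦_⟧ (∨-identityʳ (emptyᵇ S)))) (count-empty a)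

countF : ∀ k → (Fin k → Bool) → ℕ
countF zero    p = 0
countF (suc k) p = ⟦ p zero ⟧ + countF k (λ i → p (suc i))

countF-≤ : ∀ k p → countF k p ≤ k
countF-≤ zero    p = z≤n
countF-≤ (suc k) p = +-mono-≤ (⟦≤1⟧ (p zero)) (countF-≤ k _)
  where
  ⟦≤1⟧ : ∀ b → ⟦ b ⟧ ≤ 1
  ⟦≤1⟧ true  = ≤-refl
  ⟦≤1⟧ false = z≤n

⟦⟧-mono : ∀ x y → (x ≡ true → y ≡ true) → ⟦ x ⟧ ≤ ⟦ y ⟧
⟦⟧-mono true  y h rewrite h refl = ≤-refl
⟦⟧-mono false y h = z≤n

_⊆ᵇ_ : ∀ {k} → (Fin k → Bool) → (Fin k → Bool) → Set
p ⊆ᵇ q = ∀ i → p i ≡ true → q i ≡ true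

countF-mono : ∀ k (p q : Fin k → Bool) → p ⊆ᵇ q → countF k p ≤ countF k q
countF-mono zero    p q h = z≤n
countF-mono (suc k) p q h =
  +-mono-≤ (⟦⟧-mono (p zero) (q zero) (h zero)) (countF-mono k _ _ (λ i → h (suc i)))

countF-strict : ∀ k (p q : Fin k → Bool) → p ⊆ᵇ q →
  (i : Fin k) → p i ≡ false → q i ≡ true → countF k p < countF k q
countF-strict (suc k) p q h zero pi qi rewrite pi | qi = s≤s (countF-mono k _ _ (λ i → h (suc i)))
countF-strict (suc k) p q h (suc i) pi qi =
  subst (_≤ ⟦ q zero ⟧ + countF k (λ j → q (suc j))) (+-suc ⟦ p zero ⟧ _)
    (+-mono-≤ (⟦⟧-mono (p zero) (q zero) (h zero)) (countF-strict k _ _ (λ j → h (suc j)) i pi qi))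

countF-pos : ∀ k (p : Fin k → Bool) i → p i ≡ true → 1 ≤ countF k p
countF-pos (suc k) p zero    q rewrite q = s≤s z≤n
countF-pos (suc k) p (suc i) q = ≤-trans (countF-pos k _ i q) (m≤n+m _ _)

new-element : ∀ {x y} → (x ≡ true → y ≡ true) → y ≢ x → x ≡ false × y ≡ true
new-element {true}          x⇒y y≢x = ⊥-elim (y≢x (x⇒y refl))
new-element {false} {true}  x⇒y y≢x = refl , refl
new-element {false} {false} x⇒y y≢x = ⊥-elim (y≢x refl)

agree-or-differ : ∀ k (p q : Fin k → Bool) → (∀ i → p i ≡ q i) ⊎ Σ (Fin k) (λ i → p i ≢ q i)
agree-or-differ zero    p q = inj₁ (λ ())
agree-or-differ (suc k) p q with p zero ≟ᵇ q zero | agree-or-differ k (λ i → p (suc i)) (λ i → q (suc i))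
... | no  p₀≢q₀ | _                = inj₂ (zero , p₀≢q₀)
... | yes p₀≡q₀ | inj₂ (i , pᵢ≢qᵢ) = inj₂ (suc i , pᵢ≢qᵢ)
... | yes p₀≡q₀ | inj₁ same        = inj₁ λ { zero → p₀≡q₀ ; (suc i) → same i }

module Walks (G : Graph) where

  src tgt : Fin (m G) → Fin (n G)
  src e = proj₁ (ends G e)
  tgt e = proj₂ (ends G e)

  Step : Subset (m G) → ℕ → Fin (n G) → Fin (n G) → Set
  Step E k x y = Σ (Fin (m G)) λ e → lookup E e ≡ true ×
    ((src e ≡ x × reach G E k (tgt e) y ≡ true) ⊎ (tgt e ≡ x × reach G E k (src e) y ≡ true))

  reach-elim : ∀ E k x y → reach G E (suc k) x y ≡ true → reach G E k x y ≡ true ⊎ Step E k x y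
  reach-elim E k x y r with ∨-elim {reach G E k x y} r
  ... | inj₁ q = inj₁ q
  ... | inj₂ q with anyF-elim (m G) _ q
  ...   | e , q′ with ∨-elim (∧-elimʳ {lookup E e} q′)
  ...     | inj₁ w = inj₂ (e , ∧-elimˡ q′ , inj₁ (≟-sound (∧-elimˡ w) , ∧-elimʳ {⌊ src e ≟ x ⌋} w))
  ...     | inj₂ w = inj₂ (e , ∧-elimˡ q′ , inj₂ (≟-sound (∧-elimˡ w) , ∧-elimʳ {⌊ tgt e ≟ x ⌋} w))

  reach-step : ∀ E k x y → Step E k x y → reach G E (suc k) x y ≡ true
  reach-step E k x y (e , Ee , inj₁ (q , r)) =
    ∨-introʳ {reach G E k x y} (anyF-intro (m G) _ e (∧-intro Ee (∨-introˡ (∧-intro (≟-complete q) r))))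
  reach-step E k x y (e , Ee , inj₂ (q , r)) =
    ∨-introʳ {reach G E k x y} (anyF-intro (m G) _ e (∧-intro Ee
      (∨-introʳ {⌊ src e ≟ x ⌋ ∧ reach G E k (tgt e) y} (∧-intro (≟-complete q) r))))

  reach-refl : ∀ E k x → reach G E k x x ≡ true
  reach-refl E zero    x = ≟-complete refl
  reach-refl E (suc k) x = ∨-introˡ (reach-refl E k x)

  reach-mono : ∀ E k j x y → k ≤ j → reach G E k x y ≡ true → reach G E j x y ≡ true
  reach-mono E k j x y k≤j r = subst (λ t → reach G E t x y ≡ true) (m∸n+n≡m k≤j) (pad (j ∸ k) r)
    where
    pad : ∀ d → reach G E k x y ≡ true → reach G E (d + k) x y ≡ true
    pad zero    r = r
    pad (suc d) r = ∨-introˡ (pad d r)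

  reach-trans : ∀ E k j x y z → reach G E k x y ≡ true → reach G E j y z ≡ true → reach G E (k + j) x z ≡ true
  reach-trans E zero j x y z r s = subst (λ w → reach G E j w z ≡ true) (sym (≟-sound r)) s
  reach-trans E (suc k) j x y z r s with reach-elim E k x y r
  ... | inj₁ q = ∨-introˡ (reach-trans E k j x y z q s)
  ... | inj₂ (e , Ee , inj₁ (q , r′)) =
        reach-step E (k + j) x z (e , Ee , inj₁ (q , reach-trans E k j (tgt e) y z r′ s))
  ... | inj₂ (e , Ee , inj₂ (q , r′)) =
        reach-step E (k + j) x z (e , Ee , inj₂ (q , reach-trans E k j (src e) y z r′ s))

  Isolated : Subset (m G) → Fin (n G) → Set
  Isolated E y = ∀ e → lookup E e ≡ true → ¬ (src e ≡ y) × ¬ (tgt e ≡ y)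

  reach-isolated : ∀ E k x y → Isolated E y → reach G E k x y ≡ true → x ≡ y
  reach-isolated E zero x y iso r = ≟-sound r
  reach-isolated E (suc k) x y iso r with reach-elim E k x y r
  ... | inj₁ q = reach-isolated E k x y iso q
  ... | inj₂ (e , Ee , inj₁ (q , r′)) = ⊥-elim (proj₂ (iso e Ee) (reach-isolated E k (tgt e) y iso r′))
  ... | inj₂ (e , Ee , inj₂ (q , r′)) = ⊥-elim (proj₁ (iso e Ee) (reach-isolated E k (src e) y iso r′))

  -- Saturation: the sets R k = {z | reach G E k z y} increase with k; once
  -- R (suc k) = R k they stay constant, and every strict increase adds a
  -- vertex, so R (n G) is already the final set.
  module Saturation (E : Subset (m G)) (y : Fin (n G)) where
    R : ℕ → Fin (n G) → Bool
    R k z = reach G E k z y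

    -- R (suc k) is the one-step expansion of R k.
    expand : (Fin (n G) → Bool) → Fin (n G) → Bool
    expand T x = T x ∨ anyF (m G) (λ e → lookup E e ∧
      ((⌊ src e ≟ x ⌋ ∧ T (tgt e)) ∨ (⌊ tgt e ≟ x ⌋ ∧ T (src e))))

    expand-cong : ∀ T T′ → (∀ z → T z ≡ T′ z) → ∀ x → expand T x ≡ expand T′ x
    expand-cong T T′ h x = cong₂ _∨_ (h x) (anyF-cong (m G) _ _ (λ e → cong (lookup E e ∧_)
      (cong₂ _∨_ (cong (⌊ src e ≟ x ⌋ ∧_) (h (tgt e))) (cong (⌊ tgt e ≟ x ⌋ ∧_) (h (src e))))))

    Stable : ℕ → Set
    Stable k = ∀ z → R (suc k) z ≡ R k z

    stable-suc : ∀ k → Stable k → Stable (suc k)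
    stable-suc k st = expand-cong (R (suc k)) (R k) st

    stable-from : ∀ k → Stable k → ∀ d z → R (d + k) z ≡ R k z
    stable-from k st zero    z = refl
    stable-from k st (suc d) z = trans (stable-suc-iter d z) (stable-from k st d z)
      where
      stable-suc-iter : ∀ d → Stable (d + k)
      stable-suc-iter zero    = st
      stable-suc-iter (suc d) = stable-suc (d + k) (stable-suc-iter d)

    grows : ∀ k → Stable k ⊎ k < countF (n G) (R k)
    grows zero = inj₂ (countF-pos (n G) (R 0) y (≟-complete refl))
    grows (suc k) with agree-or-differ (n G) (R (suc k)) (R k)
    ... | inj₁ st = inj₁ (stable-suc k st)
    ... | inj₂ (z , differ) with grows k | new-element (∨-introˡ {R k z}) differ
    ...   | inj₁ st | _                  = ⊥-elim (differ (st z))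
    ...   | inj₂ lt | (not-in , now-in) =
            inj₂ (≤-trans (s≤s lt) (countF-strict (n G) (R k) (R (suc k)) (λ _ → ∨-introˡ) z not-in now-in))

    stable-at-n : Stable (n G)
    stable-at-n with grows (n G)
    ... | inj₁ st = st
    ... | inj₂ lt = ⊥-elim (<⇒≱ lt (countF-≤ (n G) (R (n G))))

  reach-saturate : ∀ E k x y → reach G E k x y ≡ true → reach G E (n G) x y ≡ true
  reach-saturate E k x y r with ≤-total k (n G)
  ... | inj₁ k≤n = reach-mono E k (n G) x y k≤n r
  ... | inj₂ n≤k = trans (sym (stable-from (n G) stable-at-n (k ∸ n G) x))
                         (subst (λ t → reach G E t x y ≡ true) (sym (m∸n+n≡m n≤k)) r)
    where open Saturation E y

module ConnectedSubgraphs (G : Graph) where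
  open Walks G

  EdgesInside : Subset (n G) → Subset (m G) → Set
  EdgesInside V E = ∀ e → lookup E e ≡ true → lookup V (src e) ≡ true × lookup V (tgt e) ≡ true

  conn-intro : ∀ V E → Σ (Fin (n G)) (λ x → lookup V x ≡ true) → EdgesInside V E →
    (∀ x y → lookup V x ≡ true → lookup V y ≡ true → reach G E (n G) x y ≡ true) →
    isConnSub G V E ≡ true
  conn-intro V E (x₀ , x₀∈V) closed walks = ∧-intro (anyF-intro (n G) _ x₀ x₀∈V)
    (∧-intro (allF-intro (m G) _ (λ e → ⇒-intro (λ e∈E → ∧-intro (proj₁ (closed e e∈E)) (proj₂ (closed e e∈E)))))
             (allF-intro (n G) _ (λ x → allF-intro (n G) _ (λ y → ⇒-intro (λ xy∈V →
                 walks x y (∧-elimˡ xy∈V) (∧-elimʳ {lookup V x} xy∈V))))))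

  conn-nonempty : ∀ V E → isConnSub G V E ≡ true → Σ (Fin (n G)) (λ x → lookup V x ≡ true)
  conn-nonempty V E c = anyF-elim (n G) _ (∧-elimˡ c)

  conn-inside : ∀ V E → isConnSub G V E ≡ true → EdgesInside V E
  conn-inside V E c e e∈E =
    let both = ⇒-elim (allF-elim (m G) _ (∧-elimˡ (∧-elimʳ {anyF (n G) (λ x → lookup V x)} c)) e) e∈E
    in ∧-elimˡ both , ∧-elimʳ {lookup V (src e)} both

  conn-walk : ∀ V E → isConnSub G V E ≡ true → ∀ x y → lookup V x ≡ true → lookup V y ≡ true →
    reach G E (n G) x y ≡ true
  conn-walk V E c x y x∈V y∈V =
    ⇒-elim (allF-elim (n G) _ (allF-elim (n G) _
             (∧-elimʳ {allF (m G) _} (∧-elimʳ {anyF (n G) (λ x → lookup V x)} c)) x) y)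
           (∧-intro x∈V y∈V)

  conn-edgeless : ∀ V E → (∀ e → lookup E e ≡ false) → isConnSub G V E ≡ singleᵇ V
  conn-edgeless V E none = bool-ext to from
    where
    no-edge : ∀ e → lookup E e ≡ true → ⊥
    no-edge e e∈E = false≢true (trans (sym (none e)) e∈E)
    to : isConnSub G V E ≡ true → singleᵇ V ≡ true
    to c with conn-nonempty V E c
    ... | x₀ , x₀∈V = single-complete V x₀ x₀∈V (λ x x∈V →
          reach-isolated E (n G) x x₀ (λ e e∈E → ⊥-elim (no-edge e e∈E)) (conn-walk V E c x x₀ x∈V x₀∈V))
    from : singleᵇ V ≡ true → isConnSub G V E ≡ true
    from s with single-sound V s
    ... | x₀ , x₀∈V , only = conn-intro V E (x₀ , x₀∈V) (λ e e∈E → ⊥-elim (no-edge e e∈E))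
          (λ x y x∈V y∈V → subst (λ w → reach G E (n G) x w ≡ true) (trans (only x x∈V) (sym (only y y∈V)))
                                 (reach-refl E (n G) x))

C : (G : Graph) → Subset (n G) → ℕ
C G Vs = countSub (m G) (isConnSub G Vs)

data Block (k a b : ℕ) : Fin ((k + a) + b) → Set where
  old-block : (x : Fin k) → Block k a b ((x ↑ˡ a) ↑ˡ b)
  u-block   : (i : Fin a) → Block k a b ((k ↑ʳ i) ↑ˡ b)
  v-block   : (j : Fin b) → Block k a b ((k + a) ↑ʳ j)

block : ∀ k a b z → Block k a b z
block k a b z with splitAt (k + a) z in z≡
... | inj₂ j = subst (Block k a b) (splitAt⁻¹-↑ʳ z≡) (v-block j)
... | inj₁ w with splitAt k w in w≡
...   | inj₁ x = subst (Block k a b) (trans (cong (_↑ˡ b) (splitAt⁻¹-↑ˡ w≡)) (splitAt⁻¹-↑ˡ z≡)) (old-block x)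
...   | inj₂ i = subst (Block k a b) (trans (cong (_↑ˡ b) (splitAt⁻¹-↑ʳ w≡)) (splitAt⁻¹-↑ˡ z≡)) (u-block i)

module _ {A : Set} {k a b : ℕ} (s : Vec A k) (t : Vec A a) (r : Vec A b) where
  lookup-old : ∀ x → lookup ((s ++ t) ++ r) ((x ↑ˡ a) ↑ˡ b) ≡ lookup s x
  lookup-old x = trans (lookup-++ˡ (s ++ t) r (x ↑ˡ a)) (lookup-++ˡ s t x)

  lookup-u : ∀ i → lookup ((s ++ t) ++ r) ((k ↑ʳ i) ↑ˡ b) ≡ lookup t i
  lookup-u i = trans (lookup-++ˡ (s ++ t) r (k ↑ʳ i)) (lookup-++ʳ s t i)

  lookup-v : ∀ j → lookup ((s ++ t) ++ r) ((k + a) ↑ʳ j) ≡ lookup r j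
  lookup-v j = lookup-++ʳ (s ++ t) r j

↑ˡ≢↑ʳ : ∀ k j (x : Fin k) (y : Fin j) → x ↑ˡ j ≢ k ↑ʳ y
↑ˡ≢↑ʳ k j x y eq with trans (sym (splitAt-↑ˡ k x j)) (trans (cong (splitAt k) eq) (splitAt-↑ʳ k j y))
... | ()

module Attached (G : Graph) (u v : Fin (n G)) (a b : ℕ) where
  open Walks G
  open ConnectedSubgraphs G using (conn-walk; conn-inside; conn-intro; conn-nonempty)

  H : Graph
  H = attach G u v a b

  module WH = Walks H
  module CH = ConnectedSubgraphs H

  old : Fin (n G) → Fin (n H)
  old x = (x ↑ˡ a) ↑ˡ b

  pu : Fin a → Fin (n H)
  pu i = (n G ↑ʳ i) ↑ˡ b

  pv : Fin b → Fin (n H)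
  pv j = (n G + a) ↑ʳ j

  oE : Fin (m G) → Fin (m H)
  oE e = (e ↑ˡ a) ↑ˡ b

  eu : Fin a → Fin (m H)
  eu i = (m G ↑ʳ i) ↑ˡ b

  ev : Fin b → Fin (m H)
  ev j = (m G + a) ↑ʳ j

  ends-oE : ∀ e → ends H (oE e) ≡ (old (src e) , old (tgt e))
  ends-oE e rewrite splitAt-↑ˡ (m G + a) (e ↑ˡ a) b | splitAt-↑ˡ (m G) e a = refl

  ends-eu : ∀ i → ends H (eu i) ≡ (old u , pu i)
  ends-eu i rewrite splitAt-↑ˡ (m G + a) (m G ↑ʳ i) b | splitAt-↑ʳ (m G) a i = refl

  ends-ev : ∀ j → ends H (ev j) ≡ (old v , pv j)
  ends-ev j rewrite splitAt-↑ʳ (m G + a) b j = refl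

  src-oE : ∀ e → WH.src (oE e) ≡ old (src e)
  src-oE e = cong proj₁ (ends-oE e)

  tgt-oE : ∀ e → WH.tgt (oE e) ≡ old (tgt e)
  tgt-oE e = cong proj₂ (ends-oE e)

  src-eu : ∀ i → WH.src (eu i) ≡ old u
  src-eu i = cong proj₁ (ends-eu i)

  tgt-eu : ∀ i → WH.tgt (eu i) ≡ pu i
  tgt-eu i = cong proj₂ (ends-eu i)

  src-ev : ∀ j → WH.src (ev j) ≡ old v
  src-ev j = cong proj₁ (ends-ev j)

  tgt-ev : ∀ j → WH.tgt (ev j) ≡ pv j
  tgt-ev j = cong proj₂ (ends-ev j)

  old≢pu : ∀ x i → old x ≢ pu i
  old≢pu x i eq = ↑ˡ≢↑ʳ (n G) a x i (↑ˡ-injective b _ _ eq)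

  old≢pv : ∀ x j → old x ≢ pv j
  old≢pv x j = ↑ˡ≢↑ʳ (n G + a) b (x ↑ˡ a) j

  pu≢pv : ∀ i j → pu i ≢ pv j
  pu≢pv i j = ↑ˡ≢↑ʳ (n G + a) b (n G ↑ʳ i) j

  pu-injective : ∀ i i′ → pu i ≡ pu i′ → i ≡ i′
  pu-injective i i′ eq = ↑ʳ-injective (n G) i i′ (↑ˡ-injective b _ _ eq)

  pv-injective : ∀ j j′ → pv j ≡ pv j′ → j ≡ j′
  pv-injective j j′ = ↑ʳ-injective (n G + a) j j′

  -- Collapsing every pendant vertex onto its anchor maps H back onto G.
  π : Fin (n H) → Fin (n G)
  π z = [ (λ w → [ (λ x → x) , (λ _ → u) ]′ (splitAt (n G) w)) , (λ _ → v) ]′ (splitAt (n G + a) z)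

  π-old : ∀ x → π (old x) ≡ x
  π-old x rewrite splitAt-↑ˡ (n G + a) (x ↑ˡ a) b | splitAt-↑ˡ (n G) x a = refl

  π-pu : ∀ i → π (pu i) ≡ u
  π-pu i rewrite splitAt-↑ˡ (n G + a) (n G ↑ʳ i) b | splitAt-↑ʳ (n G) a i = refl

  π-pv : ∀ j → π (pv j) ≡ v
  π-pv j rewrite splitAt-↑ʳ (n G + a) b j = refl

  module WithEdges (Es : Subset (m G)) (Et : Subset a) (Er : Subset b) where
    E' : Subset (m H)
    E' = (Es ++ Et) ++ Er

    edge-image : ∀ e → lookup E' e ≡ true →
      (Σ (Fin (m G)) λ e₀ → lookup Es e₀ ≡ true × π (WH.src e) ≡ src e₀ × π (WH.tgt e) ≡ tgt e₀)
      ⊎ π (WH.src e) ≡ π (WH.tgt e)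
    edge-image e e∈E' with block (m G) a b e
    ... | old-block e₀ = inj₁ (e₀ , trans (sym (lookup-old Es Et Er e₀)) e∈E' ,
                               trans (cong π (src-oE e₀)) (π-old (src e₀)) ,
                               trans (cong π (tgt-oE e₀)) (π-old (tgt e₀)))
    ... | u-block i = inj₂ (begin
            π (WH.src (eu i)) ≡⟨ cong π (src-eu i) ⟩
            π (old u)         ≡⟨ π-old u ⟩
            u                 ≡⟨ π-pu i ⟨
            π (pu i)          ≡⟨ cong π (tgt-eu i) ⟨
            π (WH.tgt (eu i)) ∎)
      where open ≡-Reasoning
    ... | v-block j = inj₂ (begin
            π (WH.src (ev j)) ≡⟨ cong π (src-ev j) ⟩
            π (old v)         ≡⟨ π-old v ⟩
            v                 ≡⟨ π-pv j ⟨
            π (pv j)          ≡⟨ cong π (tgt-ev j) ⟨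
            π (WH.tgt (ev j)) ∎)
      where open ≡-Reasoning

    start-cong : ∀ k {x x′ y} → x ≡ x′ → reach G Es k x y ≡ true → reach G Es k x′ y ≡ true
    start-cong k refl r = r

    walk-project : ∀ k z w → reach H E' k z w ≡ true → reach G Es k (π z) (π w) ≡ true
    walk-project zero z w r = ≟-complete (cong π (≟-sound r))
    walk-project (suc k) z w r with WH.reach-elim E' k z w r
    ... | inj₁ q = ∨-introˡ (walk-project k z w q)
    ... | inj₂ (e , e∈E' , dir) with edge-image e e∈E' | dir
    ...   | inj₁ (e₀ , e₀∈Es , s≡ , t≡) | inj₁ (s≡z , r′) =
            reach-step Es k (π z) (π w) (e₀ , e₀∈Es , inj₁ (trans (sym s≡) (cong π s≡z) , start-cong k t≡ (walk-project k _ w r′)))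
    ...   | inj₁ (e₀ , e₀∈Es , s≡ , t≡) | inj₂ (t≡z , r′) =
            reach-step Es k (π z) (π w) (e₀ , e₀∈Es , inj₂ (trans (sym t≡) (cong π t≡z) , start-cong k s≡ (walk-project k _ w r′)))
    ...   | inj₂ collapse | inj₁ (s≡z , r′) = ∨-introˡ (start-cong k (trans (sym collapse) (cong π s≡z)) (walk-project k _ w r′))
    ...   | inj₂ collapse | inj₂ (t≡z , r′) = ∨-introˡ (start-cong k (trans collapse (cong π t≡z)) (walk-project k _ w r′))

    walk-lift : ∀ k x y → reach G Es k x y ≡ true → reach H E' k (old x) (old y) ≡ true
    walk-lift zero x y r = ≟-complete (cong old (≟-sound r))
    walk-lift (suc k) x y r with reach-elim Es k x y r
    ... | inj₁ q = ∨-introˡ (walk-lift k x y q)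
    ... | inj₂ (e₀ , e₀∈Es , inj₁ (q , r′)) = WH.reach-step E' k (old x) (old y) (oE e₀ , trans (lookup-old Es Et Er e₀) e₀∈Es ,
          inj₁ (trans (src-oE e₀) (cong old q) , subst (λ t → reach H E' k t (old y) ≡ true) (sym (tgt-oE e₀)) (walk-lift k _ y r′)))
    ... | inj₂ (e₀ , e₀∈Es , inj₂ (q , r′)) = WH.reach-step E' k (old x) (old y) (oE e₀ , trans (lookup-old Es Et Er e₀) e₀∈Es ,
          inj₂ (trans (tgt-oE e₀) (cong old q) , subst (λ t → reach H E' k t (old y) ≡ true) (sym (src-oE e₀)) (walk-lift k _ y r′)))

    pu-isolated : ∀ i → lookup Et i ≡ false → WH.Isolated E' (pu i)
    pu-isolated i i∉Et e e∈E' with block (m G) a b e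
    ... | old-block e₀ = (λ q → old≢pu _ i (trans (sym (src-oE e₀)) q)) , (λ q → old≢pu _ i (trans (sym (tgt-oE e₀)) q))
    ... | u-block i′ = (λ q → old≢pu u i (trans (sym (src-eu i′)) q)) , (λ q → false≢true (trans (sym i∉Et)
          (subst (λ t → lookup Et t ≡ true) (pu-injective i′ i (trans (sym (tgt-eu i′)) q)) (trans (sym (lookup-u Es Et Er i′)) e∈E'))))
    ... | v-block j = (λ q → old≢pu v i (trans (sym (src-ev j)) q)) , (λ q → pu≢pv i j (sym (trans (sym (tgt-ev j)) q)))

    pv-isolated : ∀ j → lookup Er j ≡ false → WH.Isolated E' (pv j)
    pv-isolated j j∉Er e e∈E' with block (m G) a b e
    ... | old-block e₀ = (λ q → old≢pv _ j (trans (sym (src-oE e₀)) q)) , (λ q → old≢pv _ j (trans (sym (tgt-oE e₀)) q))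
    ... | u-block i = (λ q → old≢pv u j (trans (sym (src-eu i)) q)) , (λ q → pu≢pv i j (trans (sym (tgt-eu i)) q))
    ... | v-block j′ = (λ q → old≢pv v j (trans (sym (src-ev j′)) q)) , (λ q → false≢true (trans (sym j∉Er)
          (subst (λ t → lookup Er t ≡ true) (pv-injective j′ j (trans (sym (tgt-ev j′)) q)) (trans (sym (lookup-v Es Et Er j′)) e∈E'))))

    Edgeless : Bool
    Edgeless = emptyᵇ Es ∧ (emptyᵇ Et ∧ emptyᵇ Er)

    E'-edgeless : Edgeless ≡ true → ∀ e → lookup E' e ≡ false
    E'-edgeless none e with block (m G) a b e
    ... | old-block e₀ = trans (lookup-old Es Et Er e₀) (empty-sound Es (∧-elimˡ none) e₀)
    ... | u-block i = trans (lookup-u Es Et Er i) (empty-sound Et (∧-elimˡ (∧-elimʳ {emptyᵇ Es} none)) i)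
    ... | v-block j = trans (lookup-v Es Et Er j) (empty-sound Er (∧-elimʳ {emptyᵇ Et} (∧-elimʳ {emptyᵇ Es} none)) j)

  module Decomposition (Vs : Subset (n G)) (Vt : Subset a) (Vr : Subset b)
                       (Es : Subset (m G)) (Et : Subset a) (Er : Subset b) where
    open WithEdges Es Et Er

    V' : Subset (n H)
    V' = (Vs ++ Vt) ++ Vr

    old∈V' : ∀ x → lookup V' (old x) ≡ lookup Vs x
    old∈V' = lookup-old Vs Vt Vr

    -- Both pendant blocks of H are
    -- instances, so the facts below are proved once for both.
    record PendantBlock (c : ℕ) (anchor : Fin (n G)) (T S : Subset c) : Set where
      field
        vertex    : Fin c → Fin (n H)
        edge      : Fin c → Fin (m H)
        src-edge  : ∀ i → WH.src (edge i) ≡ old anchor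
        tgt-edge  : ∀ i → WH.tgt (edge i) ≡ vertex i
        vertex∈V' : ∀ i → lookup V' (vertex i) ≡ lookup T i
        edge∈E'   : ∀ i → lookup E' (edge i) ≡ lookup S i
        isolated  : ∀ i → lookup S i ≡ false → WH.Isolated E' (vertex i)
        not-old   : ∀ x i → old x ≢ vertex i

    u-pendants : PendantBlock a u Vt Et
    u-pendants = record
      { vertex = pu ; edge = eu ; src-edge = src-eu ; tgt-edge = tgt-eu
      ; vertex∈V' = lookup-u Vs Vt Vr ; edge∈E' = lookup-u Es Et Er
      ; isolated = pu-isolated ; not-old = old≢pu }

    v-pendants : PendantBlock b v Vr Er
    v-pendants = record
      { vertex = pv ; edge = ev ; src-edge = src-ev ; tgt-edge = tgt-ev
      ; vertex∈V' = lookup-v Vs Vt Vr ; edge∈E' = lookup-v Es Et Er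
      ; isolated = pv-isolated ; not-old = old≢pv }

    module Pendants {c anchor T S} (B : PendantBlock c anchor T S) where
      open PendantBlock B

      anchor-used : isConnSub H V' E' ≡ true → ∀ i → lookup S i ≡ true → lookup Vs anchor ≡ true
      anchor-used c i i∈S = trans (sym (old∈V' anchor))
        (subst (λ z → lookup V' z ≡ true) (src-edge i) (proj₁ (CH.conn-inside V' E' c (edge i) (trans (edge∈E' i) i∈S))))

      admissible-if-connected : ∀ x₀ → lookup Vs x₀ ≡ true → isConnSub H V' E' ≡ true →
        admissible (lookup Vs anchor) T S ≡ true
      admissible-if-connected x₀ x₀∈Vs c =
        ∧-intro (eq-complete T S (λ i → bool-ext (vertex⇒edge i) (edge⇒vertex i))) anchored
        where
        edge⇒vertex : ∀ i → lookup S i ≡ true → lookup T i ≡ true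
        edge⇒vertex i i∈S = trans (sym (vertex∈V' i))
          (subst (λ z → lookup V' z ≡ true) (tgt-edge i) (proj₂ (CH.conn-inside V' E' c (edge i) (trans (edge∈E' i) i∈S))))
        -- without its edge a pendant vertex is isolated, hence cannot reach old x₀
        vertex⇒edge : ∀ i → lookup T i ≡ true → lookup S i ≡ true
        vertex⇒edge i i∈T with lookup S i in S-i
        ... | true  = refl
        ... | false = ⊥-elim (not-old x₀ i (WH.reach-isolated E' (n H) (old x₀) (vertex i) (isolated i S-i)
                        (CH.conn-walk V' E' c (old x₀) (vertex i) (trans (old∈V' x₀) x₀∈Vs) (trans (vertex∈V' i) i∈T))))
        anchored : (emptyᵇ S ∨ lookup Vs anchor) ≡ true
        anchored with emptyᵇ S in S-empty
        ... | true  = refl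
        ... | false = anchor-used c (proj₁ (nonempty-witness S S-empty)) (proj₂ (nonempty-witness S S-empty))

      pendant-hub : admissible (lookup Vs anchor) T S ≡ true → ∀ i → lookup T i ≡ true →
        lookup Vs anchor ≡ true × reach H E' 1 (vertex i) (old anchor) ≡ true × reach H E' 1 (old anchor) (vertex i) ≡ true
      pendant-hub adm i i∈T = anchor-present , to-anchor , from-anchor
        where
        i∈S : lookup S i ≡ true
        i∈S = trans (sym (eq-sound T S (∧-elimˡ adm) i)) i∈T
        edge∈ : lookup E' (edge i) ≡ true
        edge∈ = trans (edge∈E' i) i∈S
        anchor-present : lookup Vs anchor ≡ true
        anchor-present with ∨-elim (∧-elimʳ {eqᵇ T S} adm)
        ... | inj₁ S-empty = false≢true (trans (sym (empty-sound S S-empty i)) i∈S)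
        ... | inj₂ present = present
        to-anchor : reach H E' 1 (vertex i) (old anchor) ≡ true
        to-anchor = WH.reach-step E' 0 (vertex i) (old anchor) (edge i , edge∈ , inj₂ (tgt-edge i , ≟-complete (src-edge i)))
        from-anchor : reach H E' 1 (old anchor) (vertex i) ≡ true
        from-anchor = WH.reach-step E' 0 (old anchor) (vertex i) (edge i , edge∈ , inj₁ (src-edge i , ≟-complete (tgt-edge i)))

      pendant-edge-inside : admissible (lookup Vs anchor) T S ≡ true → ∀ i → lookup S i ≡ true →
        lookup V' (WH.src (edge i)) ≡ true × lookup V' (WH.tgt (edge i)) ≡ true
      pendant-edge-inside adm i i∈S =
        subst (λ z → lookup V' z ≡ true) (sym (src-edge i)) (trans (old∈V' anchor) (proj₁ (pendant-hub adm i i∈T))) ,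
        subst (λ z → lookup V' z ≡ true) (sym (tgt-edge i)) (trans (vertex∈V' i) i∈T)
        where
        i∈T : lookup T i ≡ true
        i∈T = trans (eq-sound T S (∧-elimˡ adm) i) i∈S

      block-edgeless : isConnSub H V' E' ≡ true → emptyᵇ Vs ≡ true → emptyᵇ S ≡ true
      block-edgeless c Vs-empty = empty-complete S (λ i → ¬-not (λ i∈S →
        false≢true (trans (sym (empty-sound Vs Vs-empty anchor)) (anchor-used c i i∈S))))

    open Pendants

    cH cG PU PV : Bool
    cH = isConnSub H V' E'
    cG = isConnSub G Vs Es
    PU = admissible (lookup Vs u) Vt Et
    PV = admissible (lookup Vs v) Vr Er

    -- A connected subgraph of H meeting G restricts to one of G: edges of
    -- Es stay inside Vs, and walks project under π.
    restrict-connected : ∀ x₀ → lookup Vs x₀ ≡ true → cH ≡ true → cG ≡ true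
    restrict-connected x₀ x₀∈Vs c = conn-intro Vs Es (x₀ , x₀∈Vs) closed walks
      where
      old-inside : ∀ e₀ → lookup Es e₀ ≡ true → lookup V' (WH.src (oE e₀)) ≡ true × lookup V' (WH.tgt (oE e₀)) ≡ true
      old-inside e₀ e₀∈Es = CH.conn-inside V' E' c (oE e₀) (trans (lookup-old Es Et Er e₀) e₀∈Es)
      closed : ∀ e₀ → lookup Es e₀ ≡ true → lookup Vs (src e₀) ≡ true × lookup Vs (tgt e₀) ≡ true
      closed e₀ e₀∈Es =
        trans (sym (old∈V' (src e₀))) (subst (λ z → lookup V' z ≡ true) (src-oE e₀) (proj₁ (old-inside e₀ e₀∈Es))) ,
        trans (sym (old∈V' (tgt e₀))) (subst (λ z → lookup V' z ≡ true) (tgt-oE e₀) (proj₂ (old-inside e₀ e₀∈Es)))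
      walks : ∀ x y → lookup Vs x ≡ true → lookup Vs y ≡ true → reach G Es (n G) x y ≡ true
      walks x y x∈Vs y∈Vs = reach-saturate Es (n H) x y
        (subst₂ (λ s t → reach G Es (n H) s t ≡ true) (π-old x) (π-old y)
          (walk-project (n H) (old x) (old y)
            (CH.conn-walk V' E' c (old x) (old y) (trans (old∈V' x) x∈Vs) (trans (old∈V' y) y∈Vs))))

    -- Conversely, a connected subgraph of G with admissible pendant blocks is
    -- connected in H: every vertex of V' is one step away from an old vertex.
    glue-connected : ∀ x₀ → lookup Vs x₀ ≡ true → cG ≡ true → PU ≡ true → PV ≡ true → cH ≡ true
    glue-connected x₀ x₀∈Vs cg pU pV = CH.conn-intro V' E' (old x₀ , trans (old∈V' x₀) x₀∈Vs) closed walks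
      where
      hub : ∀ z → lookup V' z ≡ true → Σ (Fin (n G)) λ x → lookup Vs x ≡ true ×
              reach H E' 1 z (old x) ≡ true × reach H E' 1 (old x) z ≡ true
      hub z z∈V' with block (n G) a b z
      ... | old-block x = x , trans (sym (old∈V' x)) z∈V' , WH.reach-refl E' 1 (old x) , WH.reach-refl E' 1 (old x)
      ... | u-block i = u , pendant-hub u-pendants pU i (trans (sym (lookup-u Vs Vt Vr i)) z∈V')
      ... | v-block j = v , pendant-hub v-pendants pV j (trans (sym (lookup-v Vs Vt Vr j)) z∈V')
      closed : ∀ e → lookup E' e ≡ true → lookup V' (WH.src e) ≡ true × lookup V' (WH.tgt e) ≡ true
      closed e e∈E' with block (m G) a b e
      ... | old-block e₀ =
            subst (λ z → lookup V' z ≡ true) (sym (src-oE e₀)) (trans (old∈V' (src e₀)) (proj₁ (conn-inside Vs Es cg e₀ e₀∈Es))) ,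
            subst (λ z → lookup V' z ≡ true) (sym (tgt-oE e₀)) (trans (old∈V' (tgt e₀)) (proj₂ (conn-inside Vs Es cg e₀ e₀∈Es)))
        where
        e₀∈Es : lookup Es e₀ ≡ true
        e₀∈Es = trans (sym (lookup-old Es Et Er e₀)) e∈E'
      ... | u-block i = pendant-edge-inside u-pendants pU i (trans (sym (lookup-u Es Et Er i)) e∈E')
      ... | v-block j = pendant-edge-inside v-pendants pV j (trans (sym (lookup-v Es Et Er j)) e∈E')
      walks : ∀ z w → lookup V' z ≡ true → lookup V' w ≡ true → reach H E' (n H) z w ≡ true
      walks z w z∈V' w∈V' with hub z z∈V' | hub w w∈V'
      ... | x , x∈Vs , z→x , _ | y , y∈Vs , _ , y→w =
        WH.reach-saturate E' (1 + (n G + 1)) z w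
          (WH.reach-trans E' 1 (n G + 1) z (old x) w z→x
            (WH.reach-trans E' (n G) 1 (old x) (old y) w (walk-lift (n G) x y (conn-walk Vs Es cg x y x∈Vs y∈Vs)) y→w))

    edgeless-if-no-old : cH ≡ true → emptyᵇ Vs ≡ true → Edgeless ≡ true
    edgeless-if-no-old c Vs-empty = ∧-intro old-edges-absent
      (∧-intro (block-edgeless u-pendants c Vs-empty) (block-edgeless v-pendants c Vs-empty))
      where
      old-edges-absent : emptyᵇ Es ≡ true
      old-edges-absent = empty-complete Es (λ e₀ → ¬-not (λ e₀∈Es → false≢true
        (trans (sym (empty-sound Vs Vs-empty (src e₀)))
          (trans (sym (old∈V' (src e₀))) (subst (λ z → lookup V' z ≡ true) (src-oE e₀)
            (proj₁ (CH.conn-inside V' E' c (oE e₀) (trans (lookup-old Es Et Er e₀) e₀∈Es))))))))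

    connected-split : ⟦ cH ⟧ ≡ ⟦ cG ⟧ * (⟦ PU ⟧ * ⟦ PV ⟧) + ⟦ emptyᵇ Vs ∧ singleᵇ V' ⟧ * ⟦ Edgeless ⟧
    connected-split with emptyᵇ Vs in Vs-empty
    ... | false = trans (cong ⟦_⟧ meets-G)
                    (trans (⟦∧⟧ cG (PU ∧ PV)) (trans (cong (⟦ cG ⟧ *_) (⟦∧⟧ PU PV)) (sym (+-identityʳ _))))
      where
      x₀∈Vs : lookup Vs (proj₁ (nonempty-witness Vs Vs-empty)) ≡ true
      x₀∈Vs = proj₂ (nonempty-witness Vs Vs-empty)
      meets-G : cH ≡ cG ∧ (PU ∧ PV)
      meets-G = bool-ext
        (λ c → ∧-intro (restrict-connected _ x₀∈Vs c)
                 (∧-intro (admissible-if-connected u-pendants _ x₀∈Vs c) (admissible-if-connected v-pendants _ x₀∈Vs c)))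
        (λ h → glue-connected _ x₀∈Vs (∧-elimˡ h) (∧-elimˡ (∧-elimʳ {cG} h)) (∧-elimʳ {PU} (∧-elimʳ {cG} h)))
    ... | true = trans (trans (cong ⟦_⟧ misses-G) (⟦∧⟧ (singleᵇ V') Edgeless))
                   (cong (λ t → ⟦ t ⟧ * (⟦ PU ⟧ * ⟦ PV ⟧) + ⟦ singleᵇ V' ⟧ * ⟦ Edgeless ⟧) (sym cG-false))
      where
      cG-false : cG ≡ false
      cG-false = ¬-not (λ c → let (x , x∈Vs) = conn-nonempty Vs Es c in
                               false≢true (trans (sym (empty-sound Vs Vs-empty x)) x∈Vs))
      misses-G : cH ≡ singleᵇ V' ∧ Edgeless
      misses-G = bool-ext
        (λ c → let none = edgeless-if-no-old c Vs-empty in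
               ∧-intro (trans (sym (CH.conn-edgeless V' E' (E'-edgeless none))) c) none)
        (λ h → trans (CH.conn-edgeless V' E' (E'-edgeless (∧-elimʳ {singleᵇ V'} h))) (∧-elimˡ h))

  edge-count : ∀ Vs Vt Vr → C H ((Vs ++ Vt) ++ Vr) ≡
    C G Vs * (sumSub a (λ Et → ⟦ admissible (lookup Vs u) Vt Et ⟧) * sumSub b (λ Er → ⟦ admissible (lookup Vs v) Vr Er ⟧))
    + ⟦ emptyᵇ Vs ∧ singleᵇ ((Vs ++ Vt) ++ Vr) ⟧
  edge-count Vs Vt Vr =
    trans (sumSub-++₃ (m G) a b _)
    (trans (sum₃-cong (m G) a b (λ Es Et Er → Decomposition.connected-split Vs Vt Vr Es Et Er))
    (trans (sum₃-+ (m G) a b _ _)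
           (cong₂ _+_ (sum₃-product (m G) a b _ _ _) (count-empty₃ (m G) a b _))))

  F-formula : F H ≡ sumSub (n G) (λ Vs → C G Vs * (weight a (lookup Vs u) * weight b (lookup Vs v))) + (a + b)
  F-formula =
    trans (sumSub-++₃ (n G) a b (C H))
    (trans (sum₃-cong (n G) a b edge-count)
    (trans (sum₃-+ (n G) a b _ _)
           (cong₂ _+_ (sumSub-cong (n G) weighted) (count-late-singletons (n G) a b))))
    where
    weighted : ∀ Vs → sumSub a (λ Vt → sumSub b (λ Vr →
        C G Vs * (sumSub a (λ Et → ⟦ admissible (lookup Vs u) Vt Et ⟧) * sumSub b (λ Er → ⟦ admissible (lookup Vs v) Vr Er ⟧))))
      ≡ C G Vs * (weight a (lookup Vs u) * weight b (lookup Vs v))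
    weighted Vs =
      trans (sumSub-cong a (λ Vt → trans (sumSub-*ˡ b (C G Vs) _) (cong (C G Vs *_) (sumSub-*ˡ b (U Vt) W))))
      (trans (sumSub-*ˡ a (C G Vs) _)
             (cong (C G Vs *_) (trans (sumSub-*ʳ a (sumSub b W) U)
               (cong₂ _*_ (count-admissible a (lookup Vs u)) (count-admissible b (lookup Vs v))))))
      where
      U : Subset a → ℕ
      U Vt = sumSub a (λ Et → ⟦ admissible (lookup Vs u) Vt Et ⟧)
      W : Subset b → ℕ
      W Vr = sumSub b (λ Er → ⟦ admissible (lookup Vs v) Vr Er ⟧)

when : Bool → ℕ → ℕ
when β c = if β then c else 0

f-formula : ∀ G x → f G x ≡ sumSub (n G) (λ Vs → when (lookup Vs x) (C G Vs))
f-formula G x = sumSub-cong (n G) (λ Vs → count-guarded (m G) (lookup Vs x) (isConnSub G Vs))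
  where
  count-guarded : ∀ k β (g : Subset k → Bool) → countSub k (λ E → β ∧ g E) ≡ when β (countSub k g)
  count-guarded k true  g = refl
  count-guarded k false g = sumSub-zero k

-- The singleton {u} with no edges is connected; as v ∉ {u}, some vertex set
-- containing u but not v carries a connected subgraph.
singleton-separates : ∀ G (u v : Fin (n G)) → u ≢ v →
  1 ≤ sumSub (n G) (λ Vs → when (lookup Vs u ∧ not (lookup Vs v)) (C G Vs))
singleton-separates G u v u≢v =
  ≤-trans connected (subst (_≤ sumSub (n G) (λ Vs → when (lookup Vs u ∧ not (lookup Vs v)) (C G Vs)))
                           (cong₂ (λ x y → when (x ∧ not y) (C G S)) u∈S v∉S)
                           (sumSub-≥ (n G) _ S))
  where
  open ConnectedSubgraphs G using (conn-edgeless)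
  S : Subset (n G)
  S = tabulate (λ i → ⌊ i ≟ u ⌋)
  u∈S : lookup S u ≡ true
  u∈S = trans (lookup∘tabulate _ u) (≟-complete refl)
  v∉S : lookup S v ≡ false
  v∉S = trans (lookup∘tabulate _ v) (¬-not (λ t → u≢v (sym (≟-sound t))))
  connected : 1 ≤ C G S
  connected = subst (_≤ C G S)
    (cong ⟦_⟧ (trans (conn-edgeless S (replicate (m G) false) (λ e → lookup-replicate e false))
                     (single-complete S u u∈S (λ j j∈S → ≟-sound (trans (sym (lookup∘tabulate _ j)) j∈S)))))
    (sumSub-≥ (m G) (λ Es → ⟦ isConnSub G S Es ⟧) (replicate (m G) false))

pow-pred : ∀ a → Σ ℕ λ P → 2 ^ suc a ≡ 1 + P × 1 ≤ P
pow-pred a with 2 ^ a | m^n>0 2 a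
... | suc d | _ = d + suc (d + 0) , refl , ≤-trans (s≤s z≤n) (m≤n+m (suc (d + 0)) d)

transfer-pointwise : ∀ a b P Q → 2 ^ a ≡ 1 + P → 2 ^ b ≡ 1 + Q → ∀ βu βv c →
  c * (weight (a + b) βu * weight 0 βv) + Q * when βv c ≡
  c * (weight a βu * weight b βv) + (Q * P * when (βu ∧ not βv) c + Q * when βu c)
transfer-pointwise a b P Q 2^a 2^b true true c rewrite ^-distribˡ-+-* 2 a b | 2^a | 2^b = identity c P Q
  where
  identity : ∀ c P Q → c * (((1 + P) * (1 + Q)) * 1) + Q * c ≡ c * ((1 + P) * (1 + Q)) + (Q * P * 0 + Q * c)
  identity = solve-∀
transfer-pointwise a b P Q 2^a 2^b true false c rewrite ^-distribˡ-+-* 2 a b | 2^a | 2^b = identity c P Q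
  where
  identity : ∀ c P Q → c * (((1 + P) * (1 + Q)) * 1) + Q * 0 ≡ c * ((1 + P) * 1) + (Q * P * c + Q * c)
  identity = solve-∀
transfer-pointwise a b P Q 2^a 2^b false true c rewrite 2^b = identity c P Q
  where
  identity : ∀ c P Q → c * (1 * 1) + Q * c ≡ c * (1 * (1 + Q)) + (Q * P * 0 + Q * 0)
  identity = solve-∀
transfer-pointwise a b P Q 2^a 2^b false false c = identity c P Q
  where
  identity : ∀ c P Q → c * (1 * 1) + Q * 0 ≡ c * (1 * 1) + (Q * P * 0 + Q * 0)
  identity = solve-∀

-- Here p V and q V stand for u ∈ V and v ∈ V.
transfer-inequality : ∀ k (c : Subset k → ℕ) (p q : Subset k → Bool) a b →
  sumSub k (λ V → when (q V) (c V)) ≤ sumSub k (λ V → when (p V) (c V)) →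
  1 ≤ sumSub k (λ V → when (p V ∧ not (q V)) (c V)) →
  sumSub k (λ V → c V * (weight (suc a) (p V) * weight (suc b) (q V))) <
  sumSub k (λ V → c V * (weight (suc a + suc b) (p V) * weight 0 (q V)))
transfer-inequality k c p q a b fq≤fp N≥1 = +-cancelʳ-< (Q * fq) XB XA (begin-strict
  XB + Q * fq                   <⟨ +-monoʳ-< XB (+-mono-<-≤ (*-mono-≤ (*-mono-≤ Q≥1 P≥1) N≥1) (*-monoʳ-≤ Q fq≤fp)) ⟩
  XB + (Q * P * N + Q * fp)     ≡⟨ balance ⟨
  XA + Q * fq                   ∎)
  where
  open ≤-Reasoning
  P Q : ℕ
  P = proj₁ (pow-pred a)
  Q = proj₁ (pow-pred b)
  P≥1 : 1 ≤ P
  P≥1 = proj₂ (proj₂ (pow-pred a))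
  Q≥1 : 1 ≤ Q
  Q≥1 = proj₂ (proj₂ (pow-pred b))
  fp fq N XA XB : ℕ
  fp = sumSub k (λ V → when (p V) (c V))
  fq = sumSub k (λ V → when (q V) (c V))
  N  = sumSub k (λ V → when (p V ∧ not (q V)) (c V))
  XA = sumSub k (λ V → c V * (weight (suc a + suc b) (p V) * weight 0 (q V)))
  XB = sumSub k (λ V → c V * (weight (suc a) (p V) * weight (suc b) (q V)))
  -- summing transfer-pointwise over all V
  balance : XA + Q * fq ≡ XB + (Q * P * N + Q * fp)
  balance =
    trans (sym (trans (sumSub-+ k _ _) (cong (XA +_) (sumSub-*ˡ k Q _))))
    (trans (sumSub-cong k (λ V → transfer-pointwise (suc a) (suc b) P Q (proj₁ (proj₂ (pow-pred a))) (proj₁ (proj₂ (pow-pred b)))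
                                                      (p V) (q V) (c V)))
    (trans (sumSub-+ k _ _)
           (cong (XB +_) (trans (sumSub-+ k _ _) (cong₂ _+_ (sumSub-*ˡ k (Q * P) _) (sumSub-*ˡ k Q _))))))

lemma3p6 : (G : Graph) → Simple G → Connected G → n G ≥ 2 →
           (u v : Fin (n G)) → ¬ (u ≡ v) → f G u ≥ f G v →
           (n₁ n₂ : ℕ) → n₁ ≥ 1 → n₂ ≥ 1 →
           F (attach G u v (n₁ + n₂) 0) > F (attach G u v n₁ n₂)
lemma3p6 G _ _ _ u v u≢v fu≥fv (suc a) (suc b) _ _ =
  subst₂ _<_ (sym (Attached.F-formula G u v (suc a) (suc b)))
             (sym (Attached.F-formula G u v (suc a + suc b) 0))
    (+-mono-<-≤ main-sums-increase (≤-reflexive (sym (+-identityʳ (suc a + suc b)))))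
  where
  main-sums-increase :
    sumSub (n G) (λ V → C G V * (weight (suc a) (lookup V u) * weight (suc b) (lookup V v))) <
    sumSub (n G) (λ V → C G V * (weight (suc a + suc b) (lookup V u) * weight 0 (lookup V v)))
  main-sums-increase = transfer-inequality (n G) (C G) (λ V → lookup V u) (λ V → lookup V v) a b
    (subst₂ _≤_ (f-formula G v) (f-formula G u) fu≥fv)
    (singleton-separates G u v u≢v)
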